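{- Let $G$ be any finite simple graph and $S\subseteq V(G)$ any subset of its vertices. Let $T_1$ be the tree with vertices $p_1,\dots,p_6,q_1,q_2$ and edges $p_1p_2,p_2p_3,p_3p_4,p_4p_5,p_5p_6,p_3q_1,p_5q_2$, with designated attachment vertices $p_1,p_4,p_5,p_6$. Let $T_2$ be the tree with vertices $r_1,\dots,r_8$ and edges $r_1r_2,r_2r_3,r_3r_4,r_3r_5,r_5r_6,r_6r_7,r_6r_8$, with designated attachment vertices $r_2,r_3,r_4,r_7$. For $i=1,2$ let $L_i$ be the graph obtained from $T_i$ by, for each of its four attachment vertices $t$, adding a new vertex-disjoint copy $G_t$ of $G$ and joining $t$ by an edge to every vertex of $G_t$ corresponding to a vertex of $S$. Then $J(L_1;x,y)=J(L_2;x,y)$.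
   Context: For a finite simple graph $H$ and $W\subseteq V(H)$, $N_H[W]$ is the set of vertices that are in $W$ or adjacent to a vertex of $W$, and $N_H(W):=N_H[W]\setminus W$. The bivariate domination polynomial is $J(H;x,y):=\sum_{W\subseteq V(H)} x^{|W|}y^{|N_H(W)|}$. -}

module Defs where

open import Data.Nat using (ℕ; zero; suc; _+_; _*_)
open import Data.Bool using (Bool; true; false; _∧_; _∨_; not; if_then_else_)
open import Data.Fin using (Fin; toℕ; splitAt; remQuot)
open import Data.Fin.Properties using (_≟_)
open import Data.Sum using (_⊎_; inj₁; inj₂)
open import Data.Product using (_×_; _,_)
open import Data.List using (List; []; _∷_; map; _++_; length; filterᵇ; allFin)
open import Data.Bool.ListAction using (any)
open import Data.Vec using (Vec; []; _∷_; lookup)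
open import Relation.Nullary.Decidable using (⌊_⌋)
import Data.Nat as ℕ
open import Relation.Binary.PropositionalEquality using (_≡_)

Adj : ℕ → Set
Adj m = Fin m → Fin m → Bool

IsSimple : {m : ℕ} → Adj m → Set
IsSimple {m} a = ((u v : Fin m) → a u v ≡ a v u) × ((u : Fin m) → a u u ≡ false)

allSubsets : (m : ℕ) → List (Vec Bool m)
allSubsets zero = [] ∷ []
allSubsets (suc m) = map (true ∷_) (allSubsets m) ++ map (false ∷_) (allSubsets m)

countFin : (m : ℕ) → (Fin m → Bool) → ℕ
countFin m p = length (filterᵇ p (allFin m))

card : {m : ℕ} → Vec Bool m → ℕ
card {m} W = countFin m (lookup W)

-- |N_H(W)| = |N_H[W] \ W| : vertices outside W adjacent to some vertex of W
openNbhdSize : {m : ℕ} → Adj m → Vec Bool m → ℕ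
openNbhdSize {m} a W =
  countFin m (λ v → not (lookup W v) ∧ any (λ w → lookup W w ∧ a w v) (allFin m))

-- Coefficient of x^i y^j in J(H;x,y) = Σ_W x^|W| y^|N_H(W)|, i.e. the number of
-- W ⊆ V(H) with |W| = i and |N_H(W)| = j.  Two such polynomials are equal iff
-- all coefficients agree.
Jcoeff : {m : ℕ} → Adj m → ℕ → ℕ → ℕ
Jcoeff {m} a i j =
  length (filterᵇ (λ W → ⌊ card W ℕ.≟ i ⌋ ∧ ⌊ openNbhdSize a W ℕ.≟ j ⌋) (allSubsets m))

SameJ : {m m' : ℕ} → Adj m → Adj m' → Set
SameJ a b = (i j : ℕ) → Jcoeff a i j ≡ Jcoeff b i j

edgeIn : List (ℕ × ℕ) → ℕ → ℕ → Bool
edgeIn [] u v = false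
edgeIn ((a , b) ∷ es) u v =
  (⌊ a ℕ.≟ u ⌋ ∧ ⌊ b ℕ.≟ v ⌋) ∨ (⌊ a ℕ.≟ v ⌋ ∧ ⌊ b ℕ.≟ u ⌋) ∨ edgeIn es u v

treeAdj : List (ℕ × ℕ) → Adj 8
treeAdj es u v = edgeIn es (toℕ u) (toℕ v)

-- T1: p1..p6 ↦ 0..5, q1 ↦ 6, q2 ↦ 7
-- edges p1p2,p2p3,p3p4,p4p5,p5p6,p3q1,p5q2
T1edges : List (ℕ × ℕ)
T1edges = (0 , 1) ∷ (1 , 2) ∷ (2 , 3) ∷ (3 , 4) ∷ (4 , 5) ∷ (2 , 6) ∷ (4 , 7) ∷ []

T1att : Fin 4 → Fin 8
T1att Fin.zero = Fin.zero
T1att (Fin.suc Fin.zero) = Fin.suc (Fin.suc (Fin.suc Fin.zero))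
T1att (Fin.suc (Fin.suc Fin.zero)) = Fin.suc (Fin.suc (Fin.suc (Fin.suc Fin.zero)))
T1att (Fin.suc (Fin.suc (Fin.suc Fin.zero))) = Fin.suc (Fin.suc (Fin.suc (Fin.suc (Fin.suc Fin.zero))))

-- T2: r1..r8 ↦ 0..7
-- edges r1r2,r2r3,r3r4,r3r5,r5r6,r6r7,r6r8
T2edges : List (ℕ × ℕ)
T2edges = (0 , 1) ∷ (1 , 2) ∷ (2 , 3) ∷ (2 , 4) ∷ (4 , 5) ∷ (5 , 6) ∷ (5 , 7) ∷ []

T2att : Fin 4 → Fin 8
T2att Fin.zero = Fin.suc Fin.zero
T2att (Fin.suc Fin.zero) = Fin.suc (Fin.suc Fin.zero)
T2att (Fin.suc (Fin.suc Fin.zero)) = Fin.suc (Fin.suc (Fin.suc Fin.zero))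
T2att (Fin.suc (Fin.suc (Fin.suc Fin.zero))) = Fin.suc (Fin.suc (Fin.suc (Fin.suc (Fin.suc (Fin.suc Fin.zero)))))

-- Vertex set of L: Fin (8 + 4 * n); first 8 = tree vertices, then copy k ∈ Fin 4
-- (attached at att k) of G's vertex g ∈ Fin n.
data LVert (n : ℕ) : Set where
  tv : Fin 8 → LVert n
  gv : Fin 4 → Fin n → LVert n

decode : (n : ℕ) → Fin (8 + 4 * n) → LVert n
decode n i with splitAt 8 i
... | inj₁ t = tv t
... | inj₂ r with remQuot {4} n r
...   | (k , g) = gv k g

eqF : {m : ℕ} → Fin m → Fin m → Bool
eqF u v = ⌊ u ≟ v ⌋

adjL' : {n : ℕ} → Adj 8 → (Fin 4 → Fin 8) → Adj n → (Fin n → Bool) → LVert n → LVert n → Bool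
adjL' T att G S (tv u) (tv v) = T u v
adjL' T att G S (tv t) (gv k g) = eqF (att k) t ∧ S g
adjL' T att G S (gv k g) (tv t) = eqF (att k) t ∧ S g
adjL' T att G S (gv k g) (gv k' g') = eqF k k' ∧ G g g'

Lgraph : (n : ℕ) → Adj 8 → (Fin 4 → Fin 8) → Adj n → (Fin n → Bool) → Adj (8 + 4 * n)
Lgraph n T att G S u v = adjL' T att G S (decode n u) (decode n v)

L1 : (n : ℕ) → Adj n → (Fin n → Bool) → Adj (8 + 4 * n)
L1 n = Lgraph n (treeAdj T1edges) T1att

L2 : (n : ℕ) → Adj n → (Fin n → Bool) → Adj (8 + 4 * n)
L2 n = Lgraph n (treeAdj T2edges) T2att

module Submission where

-- A vertex set W of L = L(T, att) splits into its tree part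
-- U ⊆ V(T) and its parts w₀,…,w₃ in the four copies of G.  Then
--   |W|      = |U| + Σₖ |wₖ|,
--   |N_L(W)| = treeNb(U, A) + Σₖ copyNb(bₖ, wₖ),
-- where Aₖ says whether wₖ meets S (this decides whether the attachment
-- vertex att k is dominated from its copy) and bₖ says whether att k ∈ U
-- (this decides whether S is dominated inside copy k).  Hence the number of
-- W with |W| = i and |N_L(W)| = j is a sum over the pairs (U, A) of the number
-- of tuples (wₖ) with prescribed S-pattern A, and that number depends only on
-- the "profile" of (U, A): |U|, treeNb(U, A) and the multiset {(Aₖ, bₖ)}.
-- Finally, the sorted lists of profiles of the 2⁸·2⁴ pairs (U, A) are the same
-- for T₁ and T₂, which is checked by evaluation.

open import Defs
open import Data.Nat using (ℕ; zero; suc; _+_; _*_)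
import Data.Nat as ℕ
open import Data.Nat.Properties using (+-assoc; +-identityʳ; ≤-decTotalOrder; +-commutativeSemigroup)
open import Data.Nat.ListAction using (sum)
open import Data.Nat.ListAction.Properties using (sum-++; sum-↭)
open import Algebra.Properties.CommutativeSemigroup +-commutativeSemigroup using (interchange; xy∙z≈xz∙y)
open import Data.Bool using (Bool; true; false; _∧_; _∨_; not; if_then_else_)
open import Data.Bool.Properties using (∨-assoc; ∨-identityʳ; ∧-zeroʳ)
import Data.Bool.Properties as Bool
open import Data.Bool.ListAction using (any)
open import Data.Fin using (Fin; _↑ˡ_; _↑ʳ_; remQuot; combine)
open import Data.Fin.Properties using (splitAt-↑ˡ; splitAt-↑ʳ; remQuot-combine; suc-injective)
import Data.Fin.Properties as Fin
open import Data.Product using (_×_; _,_; proj₁; proj₂)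
open import Data.List using (List; []; _∷_; map; _++_; length; filterᵇ; allFin; cartesianProduct)
import Data.List as List
open import Data.List.Properties using (map-cong; map-++; map-∘)
open import Data.List.Relation.Binary.Permutation.Propositional using (_↭_; prep; swap; ↭-sym)
  renaming (refl to ↭-refl; trans to ↭-trans)
open import Data.List.Relation.Binary.Permutation.Propositional.Properties using (map⁺)
open import Data.Vec using (Vec; lookup; []; _∷_)
import Data.Vec as Vec
open import Data.Vec.Properties using (lookup-++ˡ; lookup-++ʳ; lookup-concat; lookup-map)
open import Function using (_∘_; id)
open import Relation.Binary.PropositionalEquality
open import Relation.Nullary.Decidable using (⌊_⌋; isYes≗does; dec-true; dec-false)
import Relation.Binary.Construct.On as On

𝟙 : Bool → ℕ
𝟙 b = if b then 1 else 0

sumFin : (m : ℕ) → (Fin m → ℕ) → ℕ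
sumFin zero f = 0
sumFin (suc m) f = f Fin.zero + sumFin m (f ∘ Fin.suc)

countF : (m : ℕ) → (Fin m → Bool) → ℕ
countF m p = sumFin m (𝟙 ∘ p)

anyF : (m : ℕ) → (Fin m → Bool) → Bool
anyF zero p = false
anyF (suc m) p = p Fin.zero ∨ anyF m (p ∘ Fin.suc)

-- It is
-- opaque: elsewhere only the lemmas of this block are used, so the type
-- checker never unfolds sums over the exponentially long lists of subsets.
opaque

  sumOver : {A : Set} → List A → (A → ℕ) → ℕ
  sumOver xs f = sum (map f xs)

  syntax sumOver xs (λ x → e) = ∑[ x ← xs ] e

  sumOver-singleton : {A : Set} (x : A) (f : A → ℕ) → sumOver (x ∷ []) f ≡ f x
  sumOver-singleton x f = +-identityʳ (f x)

  sumOver-cong : {A : Set} (xs : List A) {f g : A → ℕ} → (∀ x → f x ≡ g x) → sumOver xs f ≡ sumOver xs g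
  sumOver-cong xs f≗g = cong sum (map-cong f≗g xs)

  sumOver-++ : {A : Set} (xs ys : List A) (f : A → ℕ) → sumOver (xs ++ ys) f ≡ sumOver xs f + sumOver ys f
  sumOver-++ xs ys f = trans (cong sum (map-++ f xs ys)) (sum-++ (map f xs) (map f ys))

  sumOver-map : {A B : Set} (g : A → B) (xs : List A) (f : B → ℕ) → sumOver (map g xs) f ≡ ∑[ x ← xs ] f (g x)
  sumOver-map g xs f = cong sum (sym (map-∘ xs))

  sumOver-↭ : {A : Set} {xs ys : List A} (f : A → ℕ) → xs ↭ ys → sumOver xs f ≡ sumOver ys f
  sumOver-↭ f p = sum-↭ (map⁺ f p)

  sumOver-zero : {A : Set} (xs : List A) → sumOver xs (λ _ → 0) ≡ 0
  sumOver-zero [] = refl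
  sumOver-zero (x ∷ xs) = sumOver-zero xs

  sumOver-+ : {A : Set} (xs : List A) (f g : A → ℕ) → sumOver xs (λ x → f x + g x) ≡ sumOver xs f + sumOver xs g
  sumOver-+ [] f g = refl
  sumOver-+ (x ∷ xs) f g =
    trans (cong (f x + g x +_) (sumOver-+ xs f g)) (interchange (f x) (g x) (sumOver xs f) (sumOver xs g))

  sumOver-if : {A : Set} (c : Bool) (xs : List A) (f : A → ℕ) →
               (if c then sumOver xs f else 0) ≡ sumOver xs (λ x → if c then f x else 0)
  sumOver-if true xs f = refl
  sumOver-if false xs f = sym (sumOver-zero xs)

  sumOver-swap : {A B : Set} (xs : List A) (ys : List B) (f : A → B → ℕ) →
                 ∑[ x ← xs ] ∑[ y ← ys ] f x y ≡ ∑[ y ← ys ] ∑[ x ← xs ] f x y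
  sumOver-swap [] ys f = sym (sumOver-zero ys)
  sumOver-swap (x ∷ xs) ys f =
    trans (cong (sumOver ys (f x) +_) (sumOver-swap xs ys f)) (sym (sumOver-+ ys (f x) (λ y → ∑[ x' ← xs ] f x' y)))

  sumOver-cartesianProduct : {A B : Set} (xs : List A) (ys : List B) (f : A × B → ℕ) →
                             sumOver (cartesianProduct xs ys) f ≡ ∑[ x ← xs ] ∑[ y ← ys ] f (x , y)
  sumOver-cartesianProduct [] ys f = refl
  sumOver-cartesianProduct (x ∷ xs) ys f =
    trans (sumOver-++ (map (x ,_) ys) (cartesianProduct xs ys) f)
          (cong₂ _+_ (sumOver-map (x ,_) ys f) (sumOver-cartesianProduct xs ys f))

  sumOver-tabulate : {A : Set} (m : ℕ) (f : Fin m → A) (g : A → ℕ) →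
                     sumOver (List.tabulate f) g ≡ sumFin m (g ∘ f)
  sumOver-tabulate zero f g = refl
  sumOver-tabulate (suc m) f g = cong (g (f Fin.zero) +_) (sumOver-tabulate m (f ∘ Fin.suc) g)

  length-filterᵇ : {A : Set} (p : A → Bool) (xs : List A) → length (filterᵇ p xs) ≡ ∑[ x ← xs ] 𝟙 (p x)
  length-filterᵇ p [] = refl
  length-filterᵇ p (x ∷ xs) with p x
  ... | true = cong suc (length-filterᵇ p xs)
  ... | false = length-filterᵇ p xs

sumFin-cong : (m : ℕ) {f g : Fin m → ℕ} → (∀ k → f k ≡ g k) → sumFin m f ≡ sumFin m g
sumFin-cong zero f≗g = refl
sumFin-cong (suc m) f≗g = cong₂ _+_ (f≗g Fin.zero) (sumFin-cong m (f≗g ∘ Fin.suc))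

anyF-cong : (m : ℕ) {p q : Fin m → Bool} → (∀ k → p k ≡ q k) → anyF m p ≡ anyF m q
anyF-cong zero p≗q = refl
anyF-cong (suc m) p≗q = cong₂ _∨_ (p≗q Fin.zero) (anyF-cong m (p≗q ∘ Fin.suc))

countF-cong : (m : ℕ) {p q : Fin m → Bool} → (∀ k → p k ≡ q k) → countF m p ≡ countF m q
countF-cong m p≗q = sumFin-cong m (cong 𝟙 ∘ p≗q)

sumFin-↑ : (m k : ℕ) (f : Fin (m + k) → ℕ) →
           sumFin (m + k) f ≡ sumFin m (λ x → f (x ↑ˡ k)) + sumFin k (λ y → f (m ↑ʳ y))
sumFin-↑ zero k f = refl
sumFin-↑ (suc m) k f =
  trans (cong (f Fin.zero +_) (sumFin-↑ m k (f ∘ Fin.suc))) (sym (+-assoc (f Fin.zero) _ _))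

anyF-↑ : (m k : ℕ) (p : Fin (m + k) → Bool) →
         anyF (m + k) p ≡ anyF m (λ x → p (x ↑ˡ k)) ∨ anyF k (λ y → p (m ↑ʳ y))
anyF-↑ zero k p = refl
anyF-↑ (suc m) k p =
  trans (cong (p Fin.zero ∨_) (anyF-↑ m k (p ∘ Fin.suc))) (sym (∨-assoc (p Fin.zero) _ _))

sumFin-combine : (m n : ℕ) (f : Fin (m * n) → ℕ) →
                 sumFin (m * n) f ≡ sumFin m (λ k → sumFin n (λ g → f (combine k g)))
sumFin-combine zero n f = refl
sumFin-combine (suc m) n f =
  trans (sumFin-↑ n (m * n) f) (cong (sumFin n (λ g → f (g ↑ˡ (m * n))) +_) (sumFin-combine m n (λ y → f (n ↑ʳ y))))

anyF-combine : (m n : ℕ) (p : Fin (m * n) → Bool) →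
               anyF (m * n) p ≡ anyF m (λ k → anyF n (λ g → p (combine k g)))
anyF-combine zero n p = refl
anyF-combine (suc m) n p =
  trans (anyF-↑ n (m * n) p) (cong (anyF n (λ g → p (g ↑ˡ (m * n))) ∨_) (anyF-combine m n (λ y → p (n ↑ʳ y))))

anyF-false : (m : ℕ) {p : Fin m → Bool} → (∀ k → p k ≡ false) → anyF m p ≡ false
anyF-false zero off = refl
anyF-false (suc m) off rewrite off Fin.zero = anyF-false m (off ∘ Fin.suc)

anyF-single : (m : ℕ) (c : Fin m) {p : Fin m → Bool} → (∀ k → k ≢ c → p k ≡ false) → anyF m p ≡ p c
anyF-single (suc m) Fin.zero {p} off =
  trans (cong (p Fin.zero ∨_) (anyF-false m (λ k → off (Fin.suc k) (λ ())))) (∨-identityʳ _)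
anyF-single (suc m) (Fin.suc c) off rewrite off Fin.zero (λ ()) =
  anyF-single m c (λ k k≢c → off (Fin.suc k) (k≢c ∘ suc-injective))

countFin-countF : (m : ℕ) (p : Fin m → Bool) → countFin m p ≡ countF m p
countFin-countF m p = trans (length-filterᵇ p (allFin m)) (sumOver-tabulate m id (𝟙 ∘ p))

any-tabulate : {A : Set} (m : ℕ) (f : Fin m → A) (p : A → Bool) → any p (List.tabulate f) ≡ anyF m (p ∘ f)
any-tabulate zero f p = refl
any-tabulate (suc m) f p = cong (p (f Fin.zero) ∨_) (any-tabulate m (f ∘ Fin.suc) p)

eqF-refl : {m : ℕ} (c : Fin m) → eqF c c ≡ true
eqF-refl c = trans (isYes≗does (c Fin.≟ c)) (dec-true (c Fin.≟ c) refl)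

eqF-≢ : {m : ℕ} {c k : Fin m} → c ≢ k → eqF c k ≡ false
eqF-≢ {c = c} {k} c≢k = trans (isYes≗does (c Fin.≟ k)) (dec-false (c Fin.≟ k) c≢k)

sumOver-allSubsets-suc : (m : ℕ) (f : Vec Bool (suc m) → ℕ) →
  sumOver (allSubsets (suc m)) f ≡ ∑[ u ← allSubsets m ] f (true ∷ u) + ∑[ u ← allSubsets m ] f (false ∷ u)
sumOver-allSubsets-suc m f =
  trans (sumOver-++ (map (true ∷_) (allSubsets m)) _ f)
        (cong₂ _+_ (sumOver-map (true ∷_) (allSubsets m) f) (sumOver-map (false ∷_) (allSubsets m) f))

sumOver-allSubsets-++ : (m k : ℕ) (f : Vec Bool (m + k) → ℕ) →
  sumOver (allSubsets (m + k)) f ≡ ∑[ u ← allSubsets m ] ∑[ v ← allSubsets k ] f (u Vec.++ v)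
sumOver-allSubsets-++ zero k f = sym (sumOver-singleton [] (λ u → ∑[ v ← allSubsets k ] f (u Vec.++ v)))
sumOver-allSubsets-++ (suc m) k f =
  trans (sumOver-allSubsets-suc (m + k) f)
  (trans (cong₂ _+_ (sumOver-allSubsets-++ m k (f ∘ (true ∷_))) (sumOver-allSubsets-++ m k (f ∘ (false ∷_))))
         (sym (sumOver-allSubsets-suc m _)))

sumTuples : (r n : ℕ) → (Vec (Vec Bool n) r → ℕ) → ℕ
sumTuples zero n F = F []
sumTuples (suc r) n F = ∑[ w ← allSubsets n ] sumTuples r n (λ ws → F (w ∷ ws))

sumTuples-cong : (r n : ℕ) {F F' : Vec (Vec Bool n) r → ℕ} → (∀ ws → F ws ≡ F' ws) → sumTuples r n F ≡ sumTuples r n F'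
sumTuples-cong zero n F≗F' = F≗F' []
sumTuples-cong (suc r) n F≗F' = sumOver-cong (allSubsets n) (λ w → sumTuples-cong r n (λ ws → F≗F' (w ∷ ws)))

sumOver-allSubsets-concat : (r n : ℕ) (F : Vec Bool (r * n) → ℕ) →
  sumOver (allSubsets (r * n)) F ≡ sumTuples r n (F ∘ Vec.concat)
sumOver-allSubsets-concat zero n F = sumOver-singleton [] F
sumOver-allSubsets-concat (suc r) n F =
  trans (sumOver-allSubsets-++ n (r * n) F)
        (sumOver-cong (allSubsets n) (λ w → sumOver-allSubsets-concat r n (λ v → F (w Vec.++ v))))

ι : (n : ℕ) → LVert n → Fin (8 + 4 * n)
ι n (tv t) = t ↑ˡ (4 * n)
ι n (gv k g) = 8 ↑ʳ combine k g

decode-ι : {n : ℕ} (x : LVert n) → decode n (ι n x) ≡ x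
decode-ι {n} (tv t) rewrite splitAt-↑ˡ 8 t (4 * n) = refl
decode-ι {n} (gv k g) = trans (decode-copy (combine k g)) (cong (λ kg → gv (proj₁ kg) (proj₂ kg)) (remQuot-combine k g))
  where
  decode-copy : (y : Fin (4 * n)) → decode n (8 ↑ʳ y) ≡ gv (proj₁ (remQuot {4} n y)) (proj₂ (remQuot {4} n y))
  decode-copy y rewrite splitAt-↑ʳ 8 (4 * n) y = refl

sumFin-L : (n : ℕ) (f : Fin (8 + 4 * n) → ℕ) →
           sumFin (8 + 4 * n) f ≡ sumFin 8 (λ t → f (ι n (tv t))) + sumFin 4 (λ k → sumFin n (λ g → f (ι n (gv k g))))
sumFin-L n f = trans (sumFin-↑ 8 (4 * n) f) (cong (sumFin 8 (λ t → f (ι n (tv t))) +_) (sumFin-combine 4 n (λ y → f (8 ↑ʳ y))))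

anyF-L : (n : ℕ) (p : Fin (8 + 4 * n) → Bool) →
         anyF (8 + 4 * n) p ≡ anyF 8 (λ t → p (ι n (tv t))) ∨ anyF 4 (λ k → anyF n (λ g → p (ι n (gv k g))))
anyF-L n p = trans (anyF-↑ 8 (4 * n) p) (cong (anyF 8 (λ t → p (ι n (tv t))) ∨_) (anyF-combine 4 n (λ y → p (8 ↑ʳ y))))

-- The tree part of the open neighbourhood: vertices v ∉ U of T that are
-- adjacent to U, or are an attachment vertex att k whose pendant part is
-- flagged in A (in L: the copy of G at att k meets the chosen set in S).
treeNb : {m r : ℕ} → Adj m → (Fin r → Fin m) → Vec Bool m → Vec Bool r → ℕ
treeNb {m} {r} T att U A =
  countF m (λ v → not (lookup U v) ∧ (anyF m (λ u → lookup U u ∧ T u v) ∨ anyF r (λ k → eqF (att k) v ∧ lookup A k)))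

attachedIn : {m r : ℕ} → (Fin r → Fin m) → Vec Bool m → Fin r → Bool
attachedIn att U k = lookup U (att k)

pairs : {r : ℕ} → Vec Bool r → (Fin r → Bool) → List (Bool × Bool)
pairs {r} A b = List.tabulate {n = r} (λ k → lookup A k , b k)

module SortBy {A : Set} (key : A → ℕ) where
  open import Data.List.Sort.MergeSort.Base (On.decTotalOrder ≤-decTotalOrder key) public using (sort)
  open import Data.List.Sort.MergeSort.Properties (On.decTotalOrder ≤-decTotalOrder key) public using (sort-↭)

pairCode : Bool × Bool → ℕ
pairCode (a , b) = 𝟙 a * 2 + 𝟙 b

module PairSort = SortBy pairCode

-- The data of (U, A) on which the contribution to J(L) depends: |U|, the
-- tree part of the neighbourhood, and the multiset of pairs (Aₖ, bₖ).
Profile : Set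
Profile = ℕ × ℕ × List (Bool × Bool)

profile : {m r : ℕ} → Adj m → (Fin r → Fin m) → Vec Bool m × Vec Bool r → Profile
profile T att (U , A) = card U , treeNb T att U A , PairSort.sort (pairs A (attachedIn att U))

-- An injective numbering of profiles (|U| and treeNb are at most 8, and the
-- pair list is read in base 4), used only to order them.
profileCode : Profile → ℕ
profileCode (s , t , τ) = s + 9 * (t + 9 * List.foldr (λ p c → pairCode p + 4 * c) 0 τ)

module ProfileSort = SortBy profileCode

configurations : List (Vec Bool 8 × Vec Bool 4)
configurations = cartesianProduct (allSubsets 8) (allSubsets 4)

profiles : Adj 8 → (Fin 4 → Fin 8) → List Profile
profiles T att = ProfileSort.sort (map (profile T att) configurations)

sameProfiles : profiles (treeAdj T1edges) T1att ≡ profiles (treeAdj T2edges) T2att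
sameProfiles = refl

module Attached {n : ℕ} (G : Adj n) (S : Fin n → Bool) where

  -- Whether w meets S, i.e. whether w dominates the attachment vertex.
  meetsS : Vec Bool n → Bool
  meetsS w = anyF n (λ g → lookup w g ∧ S g)

  -- The part of the open neighbourhood inside a copy of G with vertex set w,
  -- when the attachment vertex is in the chosen set iff b.
  copyNb : Bool → Vec Bool n → ℕ
  copyNb b w = countF n (λ g → not (lookup w g) ∧ ((b ∧ S g) ∨ anyF n (λ h → lookup w h ∧ G h g)))

  meetsS-attached : (w : Vec Bool n) (e : Bool) → anyF n (λ g → lookup w g ∧ (e ∧ S g)) ≡ e ∧ meetsS w
  meetsS-attached w true = refl
  meetsS-attached w false = anyF-false n (λ g → ∧-zeroʳ (lookup w g))

  module Boundary (T : Adj 8) (att : Fin 4 → Fin 8) where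

    L : Adj (8 + 4 * n)
    L = Lgraph n T att G S

    module _ (U : Vec Bool 8) (ws : Vec (Vec Bool n) 4) where

      W : Vec Bool (8 + 4 * n)
      W = U Vec.++ Vec.concat ws

      inW : LVert n → Bool
      inW (tv t) = lookup U t
      inW (gv k g) = lookup (lookup ws k) g

      lookup-ι : (x : LVert n) → lookup W (ι n x) ≡ inW x
      lookup-ι (tv t) = lookup-++ˡ U (Vec.concat ws) t
      lookup-ι (gv k g) = trans (lookup-++ʳ U (Vec.concat ws) (combine k g)) (lookup-concat ws k g)

      boundary : LVert n → Bool
      boundary x = not (inW x) ∧ (anyF 8 (λ t → inW (tv t) ∧ adjL' T att G S (tv t) x)
                                  ∨ anyF 4 (λ k → anyF n (λ g → inW (gv k g) ∧ adjL' T att G S (gv k g) x)))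

      inBoundary : Fin (8 + 4 * n) → Bool
      inBoundary v = not (lookup W v) ∧ anyF (8 + 4 * n) (λ u → lookup W u ∧ L u v)

      inBoundary-ι : (x : LVert n) → inBoundary (ι n x) ≡ boundary x
      inBoundary-ι x = cong₂ (λ a b → not a ∧ b) (lookup-ι x)
        (trans (anyF-L n (λ u → lookup W u ∧ adjL' T att G S (decode n u) (decode n (ι n x))))
          (cong₂ _∨_ (anyF-cong 8 (λ t → cong₂ _∧_ (lookup-ι (tv t)) (cong₂ (adjL' T att G S) (decode-ι (tv t)) (decode-ι x))))
                     (anyF-cong 4 (λ k → anyF-cong n (λ g →
                        cong₂ _∧_ (lookup-ι (gv k g)) (cong₂ (adjL' T att G S) (decode-ι (gv k g)) (decode-ι x)))))))

      boundary-tree : (t : Fin 8) → boundary (tv t) ≡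
        not (lookup U t) ∧ (anyF 8 (λ u → lookup U u ∧ T u t) ∨ anyF 4 (λ k → eqF (att k) t ∧ lookup (Vec.map meetsS ws) k))
      boundary-tree t = cong (λ b → not (lookup U t) ∧ (anyF 8 (λ u → lookup U u ∧ T u t) ∨ b))
        (anyF-cong 4 (λ k → trans (meetsS-attached (lookup ws k) (eqF (att k) t))
                                  (cong (eqF (att k) t ∧_) (sym (lookup-map k meetsS ws)))))

      boundary-copy : (k : Fin 4) (g : Fin n) → boundary (gv k g) ≡
        not (lookup (lookup ws k) g) ∧ ((lookup U (att k) ∧ S g) ∨ anyF n (λ h → lookup (lookup ws k) h ∧ G h g))
      boundary-copy k g = cong (λ b → not (lookup (lookup ws k) g) ∧ b) (cong₂ _∨_ fromTree fromCopies)
        where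
        fromTree : anyF 8 (λ u → lookup U u ∧ (eqF (att k) u ∧ S g)) ≡ lookup U (att k) ∧ S g
        fromTree = trans (anyF-single 8 (att k) (λ u u≢att → trans (cong (λ e → lookup U u ∧ (e ∧ S g)) (eqF-≢ (u≢att ∘ sym)))
                                                                  (∧-zeroʳ (lookup U u))))
                         (cong (λ e → lookup U (att k) ∧ (e ∧ S g)) (eqF-refl (att k)))
        fromCopies : anyF 4 (λ k' → anyF n (λ h → lookup (lookup ws k') h ∧ (eqF k' k ∧ G h g)))
                     ≡ anyF n (λ h → lookup (lookup ws k) h ∧ G h g)
        fromCopies = trans (anyF-single 4 k (λ k' k'≢k → anyF-false n (λ h →
                             trans (cong (λ e → lookup (lookup ws k') h ∧ (e ∧ G h g)) (eqF-≢ k'≢k)) (∧-zeroʳ _))))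
                           (anyF-cong n (λ h → cong (λ e → lookup (lookup ws k) h ∧ (e ∧ G h g)) (eqF-refl k)))

      card-split : card W ≡ card U + sumFin 4 (λ k → card (lookup ws k))
      card-split = begin
        card W                                                         ≡⟨ countFin-countF (8 + 4 * n) (lookup W) ⟩
        countF (8 + 4 * n) (lookup W)                                  ≡⟨ sumFin-L n (𝟙 ∘ lookup W) ⟩
        countF 8 (lookup W ∘ ι n ∘ tv) + sumFin 4 (λ k → countF n (lookup W ∘ ι n ∘ gv k))
          ≡⟨ cong₂ _+_ (countF-cong 8 (lookup-ι ∘ tv)) (sumFin-cong 4 (λ k → countF-cong n (lookup-ι ∘ gv k))) ⟩
        countF 8 (lookup U) + sumFin 4 (λ k → countF n (lookup (lookup ws k)))
          ≡⟨ sym (cong₂ _+_ (countFin-countF 8 (lookup U)) (sumFin-cong 4 (λ k → countFin-countF n (lookup (lookup ws k))))) ⟩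
        card U + sumFin 4 (λ k → card (lookup ws k))                   ∎
        where open ≡-Reasoning

      nbhd-split : openNbhdSize L W ≡ treeNb T att U (Vec.map meetsS ws) + sumFin 4 (λ k → copyNb (attachedIn att U k) (lookup ws k))
      nbhd-split = begin
        openNbhdSize L W
          ≡⟨ countFin-countF (8 + 4 * n) (λ v → not (lookup W v) ∧ any (λ u → lookup W u ∧ L u v) (allFin (8 + 4 * n))) ⟩
        countF (8 + 4 * n) (λ v → not (lookup W v) ∧ any (λ u → lookup W u ∧ L u v) (allFin (8 + 4 * n)))
          ≡⟨ countF-cong (8 + 4 * n) (λ v → cong (not (lookup W v) ∧_) (any-tabulate (8 + 4 * n) (λ u → u) (λ u → lookup W u ∧ L u v))) ⟩
        countF (8 + 4 * n) inBoundary
          ≡⟨ sumFin-L n (𝟙 ∘ inBoundary) ⟩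
        countF 8 (inBoundary ∘ ι n ∘ tv) + sumFin 4 (λ k → countF n (inBoundary ∘ ι n ∘ gv k))
          ≡⟨ cong₂ _+_ (countF-cong 8 (λ t → trans (inBoundary-ι (tv t)) (boundary-tree t)))
                       (sumFin-cong 4 (λ k → countF-cong n (λ g → trans (inBoundary-ι (gv k g)) (boundary-copy k g)))) ⟩
        treeNb T att U (Vec.map meetsS ws) + sumFin 4 (λ k → copyNb (attachedIn att U k) (lookup ws k)) ∎
        where open ≡-Reasoning

  module Coefficient (i j : ℕ) where

    target : ℕ → ℕ → ℕ
    target s t = 𝟙 (⌊ s ℕ.≟ i ⌋ ∧ ⌊ t ℕ.≟ j ⌋)

    totalCard : {r : ℕ} → Vec (Vec Bool n) r → ℕ
    totalCard {r} ws = sumFin r (λ k → card (lookup ws k))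

    totalNb : {r : ℕ} → (Fin r → Bool) → Vec (Vec Bool n) r → ℕ
    totalNb {r} b ws = sumFin r (λ k → copyNb (b k) (lookup ws k))

    -- fillings s t τ counts the tuples (wₖ) of subsets of the copies with
    -- meetsS wₖ = aₖ for each (aₖ, bₖ) ∈ τ, such that adding them to a tree
    -- part of size s and neighbourhood size t gives size i and
    -- neighbourhood size j.
    fillings : ℕ → ℕ → List (Bool × Bool) → ℕ
    fillings s t [] = target s t
    fillings s t ((a , b) ∷ τ) =
      ∑[ w ← allSubsets n ] (if ⌊ meetsS w Bool.≟ a ⌋ then fillings (s + card w) (t + copyNb b w) τ else 0)

    if-if-comm : (c d : Bool) {x y : ℕ} → x ≡ y →
                 (if c then (if d then x else 0) else 0) ≡ (if d then (if c then y else 0) else 0)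
    if-if-comm true true x≡y = x≡y
    if-if-comm true false x≡y = refl
    if-if-comm false true x≡y = refl
    if-if-comm false false x≡y = refl

    fillings-↭ : {τ τ' : List (Bool × Bool)} → τ ↭ τ' → (s t : ℕ) → fillings s t τ ≡ fillings s t τ'
    fillings-↭ ↭-refl s t = refl
    fillings-↭ (prep (a , b) τ↭τ') s t = sumOver-cong (allSubsets n) (λ w →
      cong (λ x → if ⌊ meetsS w Bool.≟ a ⌋ then x else 0) (fillings-↭ τ↭τ' (s + card w) (t + copyNb b w)))
    fillings-↭ {(a , b) ∷ (a' , b') ∷ τ} {_ ∷ _ ∷ τ'} (swap _ _ τ↭τ') s t = begin
      ∑[ w ← Ws ] (if ⌊ meetsS w Bool.≟ a ⌋ then ∑[ w' ← Ws ] inner w w' else 0)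
        ≡⟨ sumOver-cong Ws (λ w → sumOver-if ⌊ meetsS w Bool.≟ a ⌋ Ws (inner w)) ⟩
      ∑[ w ← Ws ] ∑[ w' ← Ws ] (if ⌊ meetsS w Bool.≟ a ⌋ then inner w w' else 0)
        ≡⟨ sumOver-swap Ws Ws _ ⟩
      ∑[ w' ← Ws ] ∑[ w ← Ws ] (if ⌊ meetsS w Bool.≟ a ⌋ then inner w w' else 0)
        ≡⟨ sumOver-cong Ws (λ w' → sumOver-cong Ws (λ w → if-if-comm ⌊ meetsS w Bool.≟ a ⌋ ⌊ meetsS w' Bool.≟ a' ⌋
             (trans (cong₂ (λ s' t' → fillings s' t' τ) (xy∙z≈xz∙y s (card w) (card w')) (xy∙z≈xz∙y t (copyNb b w) (copyNb b' w')))
                    (fillings-↭ τ↭τ' _ _)))) ⟩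
      ∑[ w' ← Ws ] ∑[ w ← Ws ] (if ⌊ meetsS w' Bool.≟ a' ⌋ then inner' w' w else 0)
        ≡⟨ sym (sumOver-cong Ws (λ w' → sumOver-if ⌊ meetsS w' Bool.≟ a' ⌋ Ws (inner' w'))) ⟩
      ∑[ w' ← Ws ] (if ⌊ meetsS w' Bool.≟ a' ⌋ then ∑[ w ← Ws ] inner' w' w else 0) ∎
      where
      open ≡-Reasoning
      Ws : List (Vec Bool n)
      Ws = allSubsets n
      inner : Vec Bool n → Vec Bool n → ℕ
      inner w w' = if ⌊ meetsS w' Bool.≟ a' ⌋ then fillings (s + card w + card w') (t + copyNb b w + copyNb b' w') τ else 0
      inner' : Vec Bool n → Vec Bool n → ℕ
      inner' w' w = if ⌊ meetsS w Bool.≟ a ⌋ then fillings (s + card w' + card w) (t + copyNb b' w' + copyNb b w) τ' else 0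
    fillings-↭ (↭-trans τ↭τ' τ'↭τ'') s t = trans (fillings-↭ τ↭τ' s t) (fillings-↭ τ'↭τ'' s t)

    split-bool : (a : Bool) (X : Bool → ℕ) →
                 X a ≡ (if ⌊ a Bool.≟ true ⌋ then X true else 0) + (if ⌊ a Bool.≟ false ⌋ then X false else 0)
    split-bool true X = sym (+-identityʳ (X true))
    split-bool false X = refl

    -- Grouping the tuples (wₖ) by their S-pattern A = (meetsS wₖ)ₖ: the tree
    -- contribution h only sees A, so each class is counted by fillings.
    grouping : (r : ℕ) (b : Fin r → Bool) (s : ℕ) (h : Vec Bool r → ℕ) →
               sumTuples r n (λ ws → target (s + totalCard ws) (h (Vec.map meetsS ws) + totalNb b ws))
                 ≡ ∑[ A ← allSubsets r ] fillings s (h A) (pairs A b)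
    grouping zero b s h =
      trans (cong₂ target (+-identityʳ s) (+-identityʳ (h []))) (sym (sumOver-singleton [] (λ A → fillings s (h A) (pairs A b))))
    grouping (suc r) b s h = begin
      ∑[ w ← Ws ] sumTuples r n (λ ws → target (s + (card w + totalCard ws))
                                               (h (meetsS w ∷ Vec.map meetsS ws) + (copyNb (b Fin.zero) w + totalNb (b ∘ Fin.suc) ws)))
        ≡⟨ sumOver-cong Ws peel ⟩
      ∑[ w ← Ws ] branch (meetsS w) w
        ≡⟨ sumOver-cong Ws (λ w → split-bool (meetsS w) (λ a → branch a w)) ⟩
      ∑[ w ← Ws ] (guarded true w + guarded false w)
        ≡⟨ sumOver-+ Ws (guarded true) (guarded false) ⟩
      ∑[ w ← Ws ] guarded true w + ∑[ w ← Ws ] guarded false w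
        ≡⟨ cong₂ _+_ (exchange true) (exchange false) ⟩
      ∑[ A ← As ] fillings s (h (true ∷ A)) (pairs (true ∷ A) b) + ∑[ A ← As ] fillings s (h (false ∷ A)) (pairs (false ∷ A) b)
        ≡⟨ sym (sumOver-allSubsets-suc r (λ A → fillings s (h A) (pairs A b))) ⟩
      ∑[ A ← allSubsets (suc r) ] fillings s (h A) (pairs A b) ∎
      where
      open ≡-Reasoning
      Ws : List (Vec Bool n)
      Ws = allSubsets n
      As : List (Vec Bool r)
      As = allSubsets r
      branch : Bool → Vec Bool n → ℕ
      branch a w = ∑[ A ← As ] fillings (s + card w) (h (a ∷ A) + copyNb (b Fin.zero) w) (pairs A (b ∘ Fin.suc))
      peel : (w : Vec Bool n) →
             sumTuples r n (λ ws → target (s + (card w + totalCard ws))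
                                          (h (meetsS w ∷ Vec.map meetsS ws) + (copyNb (b Fin.zero) w + totalNb (b ∘ Fin.suc) ws)))
             ≡ branch (meetsS w) w
      peel w = trans (sumTuples-cong r n (λ ws → cong₂ target (sym (+-assoc s (card w) (totalCard ws)))
                                                       (sym (+-assoc (h (meetsS w ∷ Vec.map meetsS ws)) (copyNb (b Fin.zero) w) _))))
                     (grouping r (b ∘ Fin.suc) (s + card w) (λ A → h (meetsS w ∷ A) + copyNb (b Fin.zero) w))
      guarded : Bool → Vec Bool n → ℕ
      guarded a w = if ⌊ meetsS w Bool.≟ a ⌋ then branch a w else 0
      exchange : (a : Bool) → ∑[ w ← Ws ] guarded a w ≡ ∑[ A ← As ] fillings s (h (a ∷ A)) (pairs (a ∷ A) b)
      exchange a = trans (sumOver-cong Ws (λ w → sumOver-if ⌊ meetsS w Bool.≟ a ⌋ As _)) (sumOver-swap Ws As _)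

    Jcoeff-sum : {m : ℕ} (H : Adj m) → Jcoeff H i j ≡ ∑[ W ← allSubsets m ] target (card W) (openNbhdSize H W)
    Jcoeff-sum {m} H = length-filterᵇ (λ W → ⌊ card W ℕ.≟ i ⌋ ∧ ⌊ openNbhdSize H W ℕ.≟ j ⌋) (allSubsets m)

    fillingsOf : Profile → ℕ
    fillingsOf (s , t , τ) = fillings s t τ

    module _ (T : Adj 8) (att : Fin 4 → Fin 8) where
      open Boundary T att using (L; card-split; nbhd-split)

      decomposition : Jcoeff L i j ≡
        ∑[ U ← allSubsets 8 ] sumTuples 4 n (λ ws → target (card U + totalCard ws)
                                                           (treeNb T att U (Vec.map meetsS ws) + totalNb (attachedIn att U) ws))
      decomposition = begin
        Jcoeff L i j
          ≡⟨ Jcoeff-sum L ⟩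
        ∑[ W ← allSubsets (8 + 4 * n) ] target (card W) (openNbhdSize L W)
          ≡⟨ sumOver-allSubsets-++ 8 (4 * n) (λ W → target (card W) (openNbhdSize L W)) ⟩
        ∑[ U ← allSubsets 8 ] ∑[ Wc ← allSubsets (4 * n) ] target (card (U Vec.++ Wc)) (openNbhdSize L (U Vec.++ Wc))
          ≡⟨ sumOver-cong (allSubsets 8) (λ U →
               sumOver-allSubsets-concat 4 n (λ Wc → target (card (U Vec.++ Wc)) (openNbhdSize L (U Vec.++ Wc)))) ⟩
        ∑[ U ← allSubsets 8 ] sumTuples 4 n (λ ws → target (card (U Vec.++ Vec.concat ws)) (openNbhdSize L (U Vec.++ Vec.concat ws)))
          ≡⟨ sumOver-cong (allSubsets 8) (λ U → sumTuples-cong 4 n (λ ws → cong₂ target (card-split U ws) (nbhd-split U ws))) ⟩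
        ∑[ U ← allSubsets 8 ] sumTuples 4 n (λ ws → target (card U + totalCard ws)
                                                            (treeNb T att U (Vec.map meetsS ws) + totalNb (attachedIn att U) ws)) ∎
        where open ≡-Reasoning

      byProfiles : Jcoeff L i j ≡ ∑[ p ← profiles T att ] fillingsOf p
      byProfiles = begin
        Jcoeff L i j
          ≡⟨ decomposition ⟩
        ∑[ U ← allSubsets 8 ] sumTuples 4 n (λ ws → target (card U + totalCard ws)
                                                            (treeNb T att U (Vec.map meetsS ws) + totalNb (attachedIn att U) ws))
          ≡⟨ sumOver-cong (allSubsets 8) (λ U → grouping 4 (attachedIn att U) (card U) (treeNb T att U)) ⟩
        ∑[ U ← allSubsets 8 ] ∑[ A ← allSubsets 4 ] fillings (card U) (treeNb T att U A) (pairs A (attachedIn att U))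
          ≡⟨ sumOver-cong (allSubsets 8) (λ U → sumOver-cong (allSubsets 4) (λ A →
               fillings-↭ (↭-sym (PairSort.sort-↭ (pairs A (attachedIn att U)))) (card U) (treeNb T att U A))) ⟩
        ∑[ U ← allSubsets 8 ] ∑[ A ← allSubsets 4 ] fillingsOf (profile T att (U , A))
          ≡⟨ sym (sumOver-cartesianProduct (allSubsets 8) (allSubsets 4) (fillingsOf ∘ profile T att)) ⟩
        ∑[ c ← configurations ] fillingsOf (profile T att c)
          ≡⟨ sym (sumOver-map (profile T att) configurations fillingsOf) ⟩
        ∑[ p ← map (profile T att) configurations ] fillingsOf p
          ≡⟨ sym (sumOver-↭ fillingsOf (ProfileSort.sort-↭ (map (profile T att) configurations))) ⟩
        ∑[ p ← profiles T att ] fillingsOf p ∎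
        where open ≡-Reasoning

-- Both coefficients are the same sum over the common list of profiles.
mainTheorem12 : (n : ℕ) (G : Adj n) → IsSimple G → (S : Fin n → Bool) →
                    SameJ (L1 n G S) (L2 n G S)
mainTheorem12 n G _ S i j = begin
  Jcoeff (L1 n G S) i j
    ≡⟨ byProfiles (treeAdj T1edges) T1att ⟩
  ∑[ p ← profiles (treeAdj T1edges) T1att ] fillingsOf p
    ≡⟨ cong (λ ps → sumOver ps fillingsOf) sameProfiles ⟩
  ∑[ p ← profiles (treeAdj T2edges) T2att ] fillingsOf p
    ≡⟨ sym (byProfiles (treeAdj T2edges) T2att) ⟩
  Jcoeff (L2 n G S) i j ∎
  where
  open Attached.Coefficient G S i j
  open ≡-Reasoning
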